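{- Let $\mathcal P$ and $\mathcal Q$ be finite polyhedra, both of type $\{p,q\}$, such that $\mathcal P$ covers $\mathcal Q$. If $\mathcal P$ is tight, then $\mathcal P\cong\mathcal Q$.
   Context: An (abstract) polyhedron is a partially ordered set whose elements have rank 0 (vertices), 1 (edges) or 2 (faces) such that: every flag (maximal chain) consists of one vertex, one edge and one face; each edge is incident with exactly two vertices and exactly two faces; the vertex–edge graph is connected; and for every vertex $F_0$ the poset $\{G:G>F_0\}$ is isomorphic to the vertex–edge incidence poset of a connected 2-regular graph. For a flag $\Phi$ and $i\in\{0,1,2\}$, flags $\Phi$ and $\Phi^i$ are $i$-adjacent if they differ exactly in their rank-$i$ element. Type $\{p,q\}$: every face has $p$ edges and every vertex lies on $q$ edges. A finite polyhedron of type $\{p,q\}$ has at least $2pq$ flags; it is tight if it has exactly $2pq$ flags. $\mathcal P$ covers $\mathcal Q$ if there is a surjective, incidence- and rank-preserving map $\mathcal P\to\mathcal Q$ sending $i$-adjacent flags to $i$-adjacent flags. An isomorphism is an incidence- and rank-preserving bijection. -}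

module Defs where

open import Data.Nat using (ℕ; zero; suc; _*_; _<_; _≤_)
open import Data.Fin using (Fin)
open import Data.Product using (Σ; ∃; _×_; _,_)
open import Data.Sum using (_⊎_; inj₁; inj₂)
open import Data.Empty using (⊥)
open import Data.Unit using (⊤)
open import Relation.Nullary using (¬_)
open import Relation.Binary.PropositionalEquality using (_≡_; _≢_)
open import Relation.Binary.Structures using (IsPartialOrder)
open import Relation.Binary.Construct.Closure.ReflexiveTransitive using (Star)

HasSize : {A : Set} → (A → Set) → ℕ → Set
HasSize {A} P n =
  Σ (Fin n → A) λ g →
    (∀ i j → g i ≡ g j → i ≡ j) ×
    (∀ i → P (g i)) ×
    (∀ x → P x → ∃ λ i → g i ≡ x)

record Multigraph : Set₁ where
  field
    V    : Set
    E    : Set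
    end₁ : E → V
    end₂ : E → V
    loopless : ∀ e → end₁ e ≢ end₂ e

  Incident : V → E → Set
  Incident v e = (v ≡ end₁ e) ⊎ (v ≡ end₂ e)

  Adj : V → V → Set
  Adj u w = ∃ λ e → (end₁ e ≡ u × end₂ e ≡ w) ⊎ (end₁ e ≡ w × end₂ e ≡ u)

  Connected : Set
  Connected = ∀ u w → Star Adj u w

  TwoRegular : Set
  TwoRegular = ∀ v → HasSize (λ e → Incident v e) 2

  _≤ᴵ_ : V ⊎ E → V ⊎ E → Set
  inj₁ v ≤ᴵ inj₁ w = v ≡ w
  inj₁ v ≤ᴵ inj₂ e = Incident v e
  inj₂ e ≤ᴵ inj₁ v = ⊥
  inj₂ e ≤ᴵ inj₂ f = e ≡ f

-- underlying ranked poset (the rank is part of the data)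
record RankedPoset : Set₁ where
  field
    Elt  : Set
    _≤ₚ_ : Elt → Elt → Set
    isPartialOrder : IsPartialOrder _≡_ _≤ₚ_
    rank : Elt → ℕ

module Ops (R : RankedPoset) where
  open RankedPoset R

  _<ₚ_ : Elt → Elt → Set
  x <ₚ y = x ≤ₚ y × x ≢ y

  IsChain : (Elt → Set) → Set
  IsChain C = ∀ x y → C x → C y → (x ≤ₚ y) ⊎ (y ≤ₚ x)

  IsMaximalChain : (Elt → Set) → Set
  IsMaximalChain C =
    IsChain C × (∀ z → (∀ x → C x → (z ≤ₚ x) ⊎ (x ≤ₚ z)) → C z)

  IsFlag : Elt × Elt × Elt → Set
  IsFlag (v , e , f) =
    rank v ≡ 0 × rank e ≡ 1 × rank f ≡ 2 × v ≤ₚ e × e ≤ₚ f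

  Adjacent : Fin 3 → Elt × Elt × Elt → Elt × Elt × Elt → Set
  Adjacent i Φ Ψ = IsFlag Φ × IsFlag Ψ × Differ i Φ Ψ
    where
    Differ : Fin 3 → Elt × Elt × Elt → Elt × Elt × Elt → Set
    Differ Fin.zero (v , e , f) (v' , e' , f') = v ≢ v' × e ≡ e' × f ≡ f'
    Differ (Fin.suc Fin.zero) (v , e , f) (v' , e' , f') = v ≡ v' × e ≢ e' × f ≡ f'
    Differ (Fin.suc (Fin.suc Fin.zero)) (v , e , f) (v' , e' , f') = v ≡ v' × e ≡ e' × f ≢ f'

  VertexAdj : Elt → Elt → Set
  VertexAdj u w = ∃ λ e → rank e ≡ 1 × u ≤ₚ e × w ≤ₚ e

  SectionIsoIncidence : Elt → Multigraph → Set
  SectionIsoIncidence F₀ Γ =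
    Σ ((x : Elt) → F₀ <ₚ x → Multigraph.V Γ ⊎ Multigraph.E Γ) λ φ →
      (∀ x y (p : F₀ <ₚ x) (q : F₀ <ₚ y) → φ x p ≡ φ y q → x ≡ y) ×
      (∀ t → ∃ λ x → Σ (F₀ <ₚ x) λ p → φ x p ≡ t) ×
      (∀ x y (p : F₀ <ₚ x) (q : F₀ <ₚ y) →
         (x ≤ₚ y → Multigraph._≤ᴵ_ Γ (φ x p) (φ y q)) ×
         (Multigraph._≤ᴵ_ Γ (φ x p) (φ y q) → x ≤ₚ y))

record Polyhedron : Set₁ where
  field
    poset : RankedPoset
  open RankedPoset poset public
  open Ops poset public
  field
    rank≤2    : ∀ x → rank x ≤ 2
    rank-mono : ∀ x y → x <ₚ y → rank x < rank y
    flags : ∀ C → IsMaximalChain C → ∀ i → i ≤ 2 →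
            HasSize (λ x → C x × rank x ≡ i) 1
    edge-vertices : ∀ e → rank e ≡ 1 → HasSize (λ v → rank v ≡ 0 × v ≤ₚ e) 2
    edge-faces    : ∀ e → rank e ≡ 1 → HasSize (λ f → rank f ≡ 2 × e ≤ₚ f) 2
    connected : ∀ u w → rank u ≡ 0 → rank w ≡ 0 → Star VertexAdj u w
    vertex-figure : ∀ F₀ → rank F₀ ≡ 0 →
      ∃ λ (Γ : Multigraph) →
        Multigraph.Connected Γ × Multigraph.TwoRegular Γ × SectionIsoIncidence F₀ Γ

open Polyhedron

Finite : Polyhedron → Set
Finite P = ∃ λ n → HasSize (λ (_ : Elt P) → ⊤) n

HasType : Polyhedron → ℕ → ℕ → Set
HasType P p q =
  (∀ f → rank P f ≡ 2 → HasSize (λ e → rank P e ≡ 1 × _≤ₚ_ P e f) p) ×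
  (∀ v → rank P v ≡ 0 → HasSize (λ e → rank P e ≡ 1 × _≤ₚ_ P v e) q)

Tight : Polyhedron → ℕ → ℕ → Set
Tight P p q = HasSize (IsFlag P) (2 * p * q)

mapFlag : {A B : Set} → (A → B) → A × A × A → B × B × B
mapFlag h (v , e , f) = (h v , h e , h f)

Covers : Polyhedron → Polyhedron → Set
Covers P Q =
  Σ (Elt P → Elt Q) λ h →
    (∀ y → ∃ λ x → h x ≡ y) ×
    (∀ x y → _≤ₚ_ P x y → _≤ₚ_ Q (h x) (h y)) ×
    (∀ x → rank Q (h x) ≡ rank P x) ×
    (∀ i Φ Ψ → Adjacent P i Φ Ψ → Adjacent Q i (mapFlag h Φ) (mapFlag h Ψ))

Isomorphic : Polyhedron → Polyhedron → Set
Isomorphic P Q =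
  Σ (Elt P → Elt Q) λ h →
    (∀ x y → h x ≡ h y → x ≡ y) ×
    (∀ y → ∃ λ x → h x ≡ y) ×
    (∀ x y → (_≤ₚ_ P x y → _≤ₚ_ Q (h x) (h y)) × (_≤ₚ_ Q (h x) (h y) → _≤ₚ_ P x y)) ×
    (∀ x → rank Q (h x) ≡ rank P x)

-- The covering h induces a map H on flags. H is onto: a flag of Q at h x lifts to a flag of P at x
-- by walking through the connected vertex-figure of h x, each step lifting a face of the current
-- edge and passing to the other edge of that face at x; since h keeps 1- and 2-adjacent flags apart,
-- the new edge covers the next vertex of the walk. A face of Q carries 2p flags, two at each of its
-- vertices, and each vertex carries 2q flags, so Q has at least 2pq flags; P has exactly 2pq, hence
-- H is a bijection. The flags through x and through h x are equinumerous (2q, 4 or 2p according to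
-- rank), so H restricts to a bijection between them, which makes h injective. Finally h reflects
-- incidence because comparable elements of Q lie on a common flag, whose lift passes through
-- their preimages.

module Submission where

open import Defs
open import Data.Nat using (ℕ; zero; suc; _*_; _<_; _≤_; z≤n; s≤s)
open import Data.Nat.Properties using (*-comm; ≡-irrelevant; 1+n≰n)
import Data.Nat.Properties as ℕ
open import Data.Fin as Fin using (Fin; combine; remQuot; punchOut)
open import Data.Fin.Properties
  using (any?; injective⇒≤; punchOut-injective; combine-remQuot; remQuot-combine; combine-injective; <-cmp; <-asym; 0≢1+n)
open import Data.Product using (Σ; ∃; ∃₂; _×_; _,_; proj₁; proj₂; uncurry)
open import Data.Sum using (_⊎_; inj₁; inj₂; swap)
import Data.Sum as Sum
open import Data.Sum.Properties using (inj₁-injective)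
open import Data.Empty using (⊥; ⊥-elim)
open import Data.Unit using (⊤; tt)
open import Function using (_∘_; id)
open import Relation.Nullary using (yes; no; contradiction)
open import Relation.Binary.Definitions using (DecidableEquality; tri<; tri≈; tri>)
open import Relation.Binary.PropositionalEquality
  using (_≡_; _≢_; refl; sym; trans; cong; subst; subst₂; module ≡-Reasoning)
open import Relation.Binary.Structures using (IsPartialOrder)
open import Relation.Binary.Construct.Closure.ReflexiveTransitive using (Star; fold)

Fin-injective⇒surjective : ∀ {n} (f : Fin n → Fin n) → (∀ i j → f i ≡ f j → i ≡ j) →
  ∀ k → ∃ λ i → f i ≡ k
Fin-injective⇒surjective {zero} f f-inj ()
Fin-injective⇒surjective {suc n} f f-inj k with any? (λ i → f i Fin.≟ k)
... | yes k∈image = k∈image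
... | no k∉image = contradiction (injective⇒≤ f′-inj) 1+n≰n
  where
  f≢k : ∀ i → k ≢ f i
  f≢k i k≡fi = k∉image (i , sym k≡fi)
  f′ : Fin (suc n) → Fin n
  f′ i = punchOut (f≢k i)
  f′-inj : ∀ {i j} → f′ i ≡ f′ j → i ≡ j
  f′-inj {i} {j} eq = f-inj i j (punchOut-injective (f≢k i) (f≢k j) eq)

remQuot-injective : ∀ {m} n (i j : Fin (m * n)) → remQuot {m} n i ≡ remQuot n j → i ≡ j
remQuot-injective {m} n i j eq = begin
  i                                 ≡⟨ combine-remQuot {m} n i ⟨
  uncurry combine (remQuot {m} n i) ≡⟨ cong (uncurry combine) eq ⟩
  uncurry combine (remQuot {m} n j) ≡⟨ combine-remQuot {m} n j ⟩
  j                                 ∎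
  where open ≡-Reasoning

module Pigeonhole {B : Set} (Pr : B → Set) {n : ℕ} (f g : Fin n → B)
  (f-Pr : ∀ i → Pr (f i)) (f-injective : ∀ i j → f i ≡ f j → i ≡ j)
  (g-onto : ∀ b → Pr b → ∃ λ j → g j ≡ b) where

  private
    s : Fin n → Fin n
    s i = proj₁ (g-onto (f i) (f-Pr i))

    g∘s : ∀ i → g (s i) ≡ f i
    g∘s i = proj₂ (g-onto (f i) (f-Pr i))

    s-onto : ∀ j → ∃ λ i → s i ≡ j
    s-onto = Fin-injective⇒surjective s λ i j si≡sj →
      f-injective i j (trans (sym (g∘s i)) (trans (cong g si≡sj) (g∘s j)))

  f-onto : ∀ b → Pr b → ∃ λ i → f i ≡ b
  f-onto b pb with g-onto b pb
  ... | j , gj≡b with s-onto j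
  ... | i , refl = i , trans (sym (g∘s i)) gj≡b

  g-injective : ∀ j j′ → g j ≡ g j′ → j ≡ j′
  g-injective j j′ eq with s-onto j | s-onto j′
  ... | i , refl | i′ , refl =
    cong s (f-injective i i′ (trans (sym (g∘s i)) (trans eq (g∘s i′))))

HasSize-element : ∀ {A : Set} {Pr : A → Set} {n} → HasSize Pr n → Fin n → ∃ Pr
HasSize-element (g , _ , g-Pr , _) i = g i , g-Pr i

HasSize-index : ∀ {A : Set} {Pr : A → Set} {n} → HasSize Pr n → ∀ {a} → Pr a → Fin n
HasSize-index (_ , _ , _ , g-onto) pa = proj₁ (g-onto _ pa)

HasSize-decEq : ∀ {A : Set} {n} → HasSize {A} (λ _ → ⊤) n → DecidableEquality A
HasSize-decEq (g , g-inj , _ , g-onto) x y with g-onto x tt | g-onto y tt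
... | i , refl | j , refl with i Fin.≟ j
... | yes refl = yes refl
... | no i≢j = no (i≢j ∘ g-inj i j)

HasSize-two : ∀ {A : Set} {Pr : A → Set} → HasSize Pr 2 →
  ∀ {a b c} → Pr a → Pr b → a ≢ b → Pr c → c ≡ a ⊎ c ≡ b
HasSize-two (g , _ , _ , g-onto) pa pb a≢b pc
  with g-onto _ pa | g-onto _ pb | g-onto _ pc
... | Fin.zero , refl | Fin.zero , refl | _ , _ = contradiction refl a≢b
... | Fin.suc Fin.zero , refl | Fin.suc Fin.zero , refl | _ , _ = contradiction refl a≢b
... | Fin.zero , refl | _ , refl | Fin.zero , refl = inj₁ refl
... | _ , refl | Fin.zero , refl | Fin.zero , refl = inj₂ refl
... | Fin.suc Fin.zero , refl | _ , refl | Fin.suc Fin.zero , refl = inj₁ refl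
... | _ , refl | Fin.suc Fin.zero , refl | Fin.suc Fin.zero , refl = inj₂ refl

HasSize-other : ∀ {A : Set} {Pr : A → Set} → HasSize Pr 2 → ∀ {a} → Pr a → ∃ λ b → Pr b × a ≢ b
HasSize-other (g , g-inj , g-Pr , g-onto) pa with g-onto _ pa
... | Fin.zero , refl = g (Fin.suc Fin.zero) , g-Pr _ , 0≢1+n ∘ g-inj _ _
... | Fin.suc Fin.zero , refl = g Fin.zero , g-Pr _ , 0≢1+n ∘ sym ∘ g-inj _ _

HasSize-pairs : ∀ {A B C : Set} {PA : A → Set} {PB : A → B → Set} {Pr : C → Set} {k l}
  (m : A → B → C) → (∀ a b a′ b′ → m a b ≡ m a′ b′ → a ≡ a′ × b ≡ b′) →
  HasSize PA k → (∀ a → PA a → HasSize (PB a) l) →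
  (∀ a b → PA a → PB a b → Pr (m a b)) →
  (∀ c → Pr c → ∃₂ λ a b → PA a × PB a b × m a b ≡ c) →
  HasSize Pr (k * l)
HasSize-pairs {C = C} {PB = PB} {Pr} {k} {l} m m-inj (gA , gA-inj , gA-PA , gA-onto) sizeB m-Pr m-onto =
  enum , enum-inj , enum-Pr , enum-onto
  where
  sizeB′ : ∀ i → HasSize (PB (gA i)) l
  sizeB′ i = sizeB (gA i) (gA-PA i)

  pair : Fin k × Fin l → C
  pair (i , j) = m (gA i) (proj₁ (sizeB′ i) j)

  pair-inj : ∀ ij ij′ → pair ij ≡ pair ij′ → ij ≡ ij′
  pair-inj (i , j) (i′ , j′) eq with m-inj _ _ _ _ eq
  ... | gAi≡gAi′ , gBj≡gBj′ with gA-inj i i′ gAi≡gAi′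
  ... | refl = cong (i ,_) (proj₁ (proj₂ (sizeB′ i)) j j′ gBj≡gBj′)

  enum : Fin (k * l) → C
  enum = pair ∘ remQuot l

  enum-inj : ∀ c c′ → enum c ≡ enum c′ → c ≡ c′
  enum-inj c c′ eq = remQuot-injective l c c′ (pair-inj _ _ eq)

  pair-Pr : ∀ ij → Pr (pair ij)
  pair-Pr (i , j) = m-Pr _ _ (gA-PA i) (proj₁ (proj₂ (proj₂ (sizeB′ i))) j)

  enum-Pr : ∀ c → Pr (enum c)
  enum-Pr = pair-Pr ∘ remQuot l

  enum-onto : ∀ c → Pr c → ∃ λ x → enum x ≡ c
  enum-onto c pc with m-onto c pc
  ... | a , b , pa , pb , refl with gA-onto a pa
  ... | i , refl with proj₂ (proj₂ (proj₂ (sizeB′ i))) b pb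
  ... | j , refl = combine i j , cong pair (remQuot-combine i j)

order : ∀ {n} → Fin n → Fin n → Fin 2
order i j with <-cmp i j
... | tri< _ _ _ = Fin.zero
... | _          = Fin.suc Fin.zero

order-antisym : ∀ {n} {i j : Fin n} → i ≢ j → order i j ≢ order j i
order-antisym {i = i} {j} i≢j with <-cmp i j | <-cmp j i
... | tri< i<j _ _ | tri< j<i _ _ = λ _ → <-asym i<j j<i
... | tri< _ _ _   | tri≈ _ j≡i _ = λ _ → i≢j (sym j≡i)
... | tri< _ _ _   | tri> _ _ _   = λ ()
... | tri≈ _ i≡j _ | _            = λ _ → i≢j i≡j
... | tri> _ _ _   | tri< _ _ _   = λ ()
... | tri> _ _ _   | tri≈ _ j≡i _ = λ _ → i≢j (sym j≡i)
... | tri> _ _ j<i | tri> _ _ i<j = λ _ → <-asym i<j j<i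

<≤2-cases : ∀ {r s} → r < s → s ≤ 2 → (r ≡ 0 × s ≡ 1) ⊎ (r ≡ 0 × s ≡ 2) ⊎ (r ≡ 1 × s ≡ 2)
<≤2-cases {zero} {suc zero} _ _ = inj₁ (refl , refl)
<≤2-cases {zero} {suc (suc zero)} _ _ = inj₂ (inj₁ (refl , refl))
<≤2-cases {suc zero} {suc (suc zero)} _ _ = inj₂ (inj₂ (refl , refl))
<≤2-cases {suc zero} {suc zero} (s≤s ()) _
<≤2-cases {suc (suc _)} {suc (suc zero)} (s≤s (s≤s ())) _
<≤2-cases {_} {suc (suc (suc _))} _ (s≤s (s≤s ()))

0<m<n≤2⇒m≡1×n≡2 : ∀ {m n} → 0 < m → m < n → n ≤ 2 → m ≡ 1 × n ≡ 2
0<m<n≤2⇒m≡1×n≡2 0<m m<n n≤2 with <≤2-cases m<n n≤2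
... | inj₂ (inj₂ m≡1×n≡2) = m≡1×n≡2
... | inj₁ (refl , _) = contradiction 0<m λ ()
... | inj₂ (inj₁ (refl , _)) = contradiction 0<m λ ()

module MultigraphProperties (Γ : Multigraph) where
  open Multigraph Γ

  ≤ᴵ-antisym : ∀ {s t} → s ≤ᴵ t → t ≤ᴵ s → s ≡ t
  ≤ᴵ-antisym {inj₁ _} {inj₁ _} refl _ = refl
  ≤ᴵ-antisym {inj₁ _} {inj₂ _} _ ()
  ≤ᴵ-antisym {inj₂ _} {inj₁ _} ()
  ≤ᴵ-antisym {inj₂ _} {inj₂ _} refl _ = refl

  other-end : ∀ {u g} → Incident u g →
    ∃ λ u′ → u ≢ u′ × Incident u′ g × (∀ w → Incident w g → w ≡ u ⊎ w ≡ u′)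
  other-end {g = g} (inj₁ refl) = end₂ g , loopless g , inj₂ refl , λ _ → id
  other-end {g = g} (inj₂ refl) = end₁ g , loopless g ∘ sym , inj₁ refl , λ _ → swap

  Adj⇒edge : ∀ {u u′} → Adj u u′ → ∃ λ g → Incident u g × (∀ w → Incident w g → w ≡ u ⊎ w ≡ u′)
  Adj⇒edge (g , inj₁ (refl , refl)) = g , inj₁ refl , λ _ → id
  Adj⇒edge (g , inj₂ (refl , refl)) = g , inj₂ refl , λ _ → swap

component : ∀ {A : Set} → ℕ → A × A × A → A
component zero          (v , _ , _) = v
component (suc zero)    (_ , e , _) = e
component (suc (suc _)) (_ , _ , f) = f

component-mapFlag : ∀ {A B : Set} r (h : A → B) Φ → component r (mapFlag h Φ) ≡ h (component r Φ)
component-mapFlag zero          h Φ = refl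
component-mapFlag (suc zero)    h Φ = refl
component-mapFlag (suc (suc _)) h Φ = refl

flagCount : ℕ → ℕ → ℕ → ℕ
flagCount p q zero          = q * 2
flagCount p q (suc zero)    = 2 * 2
flagCount p q (suc (suc _)) = p * 2

flagCount-index : ∀ {p q} → Fin p → Fin q → ∀ r → Fin (flagCount p q r)
flagCount-index i j zero          = combine j Fin.zero
flagCount-index i j (suc zero)    = Fin.zero
flagCount-index i j (suc (suc _)) = combine i Fin.zero

module PolyhedronFacts (X : Polyhedron) where
  open Polyhedron X public
  open IsPartialOrder isPartialOrder public
    using () renaming (refl to ≤-refl; trans to ≤-trans; reflexive to ≤-reflexive)

  Flag : Set
  Flag = Elt × Elt × Elt

  FlagAt : ℕ → Elt → Flag → Set
  FlagAt r x Φ = IsFlag Φ × component r Φ ≡ x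

  FlagsAtLeast : ℕ → Set
  FlagsAtLeast n = Σ (Fin n → Flag) λ g → (∀ i j → g i ≡ g j → i ≡ j) × (∀ i → IsFlag (g i))

  rank-< : ∀ {x y} → x <ₚ y → rank x < rank y
  rank-< = rank-mono _ _

  ≤∧rank<⇒< : ∀ {x y} → x ≤ₚ y → rank x < rank y → x <ₚ y
  ≤∧rank<⇒< x≤y rx<ry = x≤y , λ { refl → ℕ.<-irrefl refl rx<ry }

  component-≤ : ∀ {Φ r s} → IsFlag Φ → r ≤ s → component r Φ ≤ₚ component s Φ
  component-≤ {r = zero}        {zero}        _                     _ = ≤-refl
  component-≤ {r = zero}        {suc zero}    (_ , _ , _ , ve , _)  _ = ve
  component-≤ {r = zero}        {suc (suc _)} (_ , _ , _ , ve , ef) _ = ≤-trans ve ef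
  component-≤ {r = suc zero}    {suc zero}    _                     _ = ≤-refl
  component-≤ {r = suc zero}    {suc (suc _)} (_ , _ , _ , _ , ef)  _ = ef
  component-≤ {r = suc (suc _)} {suc (suc _)} _                     _ = ≤-refl
  component-≤ {r = suc _}       {zero}        _ ()
  component-≤ {r = suc (suc _)} {suc zero}    _ (s≤s ())

  record OtherEdge (v e f : Elt) : Set where
    field
      edge     : Elt
      rank≡1   : rank edge ≡ 1
      vertex≤  : v ≤ₚ edge
      ≤face    : edge ≤ₚ f
      distinct : e ≢ edge
      unique   : ∀ e′ → rank e′ ≡ 1 → v ≤ₚ e′ → e′ ≤ₚ f → e′ ≡ e ⊎ e′ ≡ edge

  -- elt inverts the isomorphism between the section above v and the incidence poset of the
  -- vertex-figure Γ: vertices of Γ are edges at v, edges of Γ are faces at v.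
  module VertexFigure {v : Elt} (rv : rank v ≡ 0) where
    Γ : Multigraph
    Γ = proj₁ (vertex-figure v rv)

    open Multigraph Γ public
    open MultigraphProperties Γ public

    Γ-connected : Connected
    Γ-connected = proj₁ (proj₂ (vertex-figure v rv))

    Γ-two-regular : TwoRegular
    Γ-two-regular = proj₁ (proj₂ (proj₂ (vertex-figure v rv)))

    private
      section≅ : SectionIsoIncidence v Γ
      section≅ = proj₂ (proj₂ (proj₂ (vertex-figure v rv)))

      φ : ∀ x → v <ₚ x → V ⊎ E
      φ = proj₁ section≅

    elt : V ⊎ E → Elt
    elt t = proj₁ (proj₁ (proj₂ (proj₂ section≅)) t)

    elt-above : ∀ t → v <ₚ elt t
    elt-above t = proj₁ (proj₂ (proj₁ (proj₂ (proj₂ section≅)) t))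

    private
      φ-elt : ∀ t → φ (elt t) (elt-above t) ≡ t
      φ-elt t = proj₂ (proj₂ (proj₁ (proj₂ (proj₂ section≅)) t))

      φ-order : ∀ s t → (elt s ≤ₚ elt t → φ _ (elt-above s) ≤ᴵ φ _ (elt-above t)) ×
                        (φ _ (elt-above s) ≤ᴵ φ _ (elt-above t) → elt s ≤ₚ elt t)
      φ-order s t = proj₂ (proj₂ (proj₂ section≅)) _ _ (elt-above s) (elt-above t)

    elt-≤ᴵ : ∀ {s t} → elt s ≤ₚ elt t → s ≤ᴵ t
    elt-≤ᴵ {s} {t} = subst₂ _≤ᴵ_ (φ-elt s) (φ-elt t) ∘ proj₁ (φ-order s t)

    ≤ᴵ-elt : ∀ {s t} → s ≤ᴵ t → elt s ≤ₚ elt t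
    ≤ᴵ-elt {s} {t} = proj₂ (φ-order s t) ∘ subst₂ _≤ᴵ_ (sym (φ-elt s)) (sym (φ-elt t))

    elt-injective : ∀ {s t} → elt s ≡ elt t → s ≡ t
    elt-injective eq = ≤ᴵ-antisym (elt-≤ᴵ (≤-reflexive eq)) (elt-≤ᴵ (≤-reflexive (sym eq)))

    elt-onto : ∀ {x} → v <ₚ x → ∃ λ t → elt t ≡ x
    elt-onto {x} v<x =
      φ x v<x , proj₁ (proj₂ section≅) _ _ (elt-above _) v<x (φ-elt (φ x v<x))

    elt-vertex<elt-edge : ∀ {u g} → Incident u g → elt (inj₁ u) <ₚ elt (inj₂ g)
    elt-vertex<elt-edge u∈g = ≤ᴵ-elt u∈g , λ eq → contradiction (elt-injective eq) λ ()

    0<rank-elt : ∀ t → 0 < rank (elt t)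
    0<rank-elt t = subst (_< rank (elt t)) rv (rank-< (elt-above t))

    rank-elt-vertex : ∀ u → rank (elt (inj₁ u)) ≡ 1
    rank-elt-vertex u = proj₁ (0<m<n≤2⇒m≡1×n≡2 (0<rank-elt _) (rank-< (elt-vertex<elt-edge u∈g)) (rank≤2 _))
      where
      u∈g : Incident u (proj₁ (Γ-two-regular u) Fin.zero)
      u∈g = proj₁ (proj₂ (proj₂ (Γ-two-regular u))) Fin.zero

    rank-elt-edge : ∀ g → rank (elt (inj₂ g)) ≡ 2
    rank-elt-edge g =
      proj₂ (0<m<n≤2⇒m≡1×n≡2 (0<rank-elt _) (rank-< (elt-vertex<elt-edge {end₁ g} (inj₁ refl))) (rank≤2 _))

    vertex-of : ∀ {e} → v ≤ₚ e → rank e ≡ 1 → ∃ λ u → elt (inj₁ u) ≡ e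
    vertex-of v≤e re with elt-onto (≤∧rank<⇒< v≤e (subst₂ _<_ (sym rv) (sym re) (s≤s z≤n)))
    ... | inj₁ u , eq = u , eq
    ... | inj₂ g , refl = contradiction (trans (sym (rank-elt-edge g)) re) λ ()

    edge-of : ∀ {f} → v ≤ₚ f → rank f ≡ 2 → ∃ λ g → elt (inj₂ g) ≡ f
    edge-of v≤f rf with elt-onto (≤∧rank<⇒< v≤f (subst₂ _<_ (sym rv) (sym rf) (s≤s z≤n)))
    ... | inj₁ u , refl = contradiction (trans (sym (rank-elt-vertex u)) rf) λ ()
    ... | inj₂ g , eq = g , eq

    edge-between : ∀ {f} → v ≤ₚ f → rank f ≡ 2 → ∃ λ e → rank e ≡ 1 × v ≤ₚ e × e ≤ₚ f
    edge-between v≤f rf with edge-of v≤f rf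
    ... | g , refl = elt (inj₁ (end₁ g)) , rank-elt-vertex _ , proj₁ (elt-above _) , ≤ᴵ-elt (inj₁ refl)

    abstract
      diamond : ∀ {e f} → rank e ≡ 1 → rank f ≡ 2 → v ≤ₚ e → e ≤ₚ f → OtherEdge v e f
      diamond re rf v≤e e≤f with vertex-of v≤e re | edge-of (≤-trans v≤e e≤f) rf
      ... | u , refl | g , refl with other-end (elt-≤ᴵ e≤f)
      ... | u′ , u≢u′ , u′∈g , g-ends = record
        { edge     = elt (inj₁ u′)
        ; rank≡1   = rank-elt-vertex u′
        ; vertex≤  = proj₁ (elt-above _)
        ; ≤face    = ≤ᴵ-elt u′∈g
        ; distinct = u≢u′ ∘ inj₁-injective ∘ elt-injective
        ; unique   = unique
        }
        where
        unique : ∀ e′ → rank e′ ≡ 1 → v ≤ₚ e′ → e′ ≤ₚ elt (inj₂ g) →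
                 e′ ≡ elt (inj₁ u) ⊎ e′ ≡ elt (inj₁ u′)
        unique e′ re′ v≤e′ e′≤f with vertex-of v≤e′ re′
        ... | u″ , refl = Sum.map (cong (elt ∘ inj₁)) (cong (elt ∘ inj₁)) (g-ends u″ (elt-≤ᴵ e′≤f))

  other-edge : ∀ {Φ} → IsFlag Φ → OtherEdge (component 0 Φ) (component 1 Φ) (component 2 Φ)
  other-edge (rv , re , rf , v≤e , e≤f) = VertexFigure.diamond rv re rf v≤e e≤f

  swap₁ : ∀ {Φ} → IsFlag Φ → Flag
  swap₁ {Φ} fl = component 0 Φ , OtherEdge.edge (other-edge fl) , component 2 Φ

  swap₁-flag : ∀ {Φ} (fl : IsFlag Φ) → IsFlag (swap₁ fl)
  swap₁-flag fl@(rv , _ , rf , _ , _) = rv , rank≡1 , rf , vertex≤ , ≤face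
    where open OtherEdge (other-edge fl)

  swap₁-≢ : ∀ {Φ} (fl : IsFlag Φ) → Φ ≢ swap₁ fl
  swap₁-≢ fl = OtherEdge.distinct (other-edge fl) ∘ cong (component 1)

  swap₁-unique : ∀ {Φ Ψ} (fl : IsFlag Φ) → IsFlag Ψ →
    component 0 Ψ ≡ component 0 Φ → component 2 Ψ ≡ component 2 Φ → Ψ ≡ Φ ⊎ Ψ ≡ swap₁ fl
  swap₁-unique fl (_ , re , _ , v≤e , e≤f) refl refl =
    Sum.map (cong (λ e → _ , e , _)) (cong (λ e → _ , e , _)) (OtherEdge.unique (other-edge fl) _ re v≤e e≤f)

  common-flag : ∀ {x y r s} → rank x ≡ r → rank y ≡ s → x <ₚ y →
    ∃ λ Φ → FlagAt r x Φ × component s Φ ≡ y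
  common-flag {x} {y} rx ry x<y@(x≤y , _) with <≤2-cases (subst₂ _<_ rx ry (rank-< x<y)) (subst (_≤ 2) ry (rank≤2 y))
  ... | inj₁ (refl , refl) =
    let f , (rf , y≤f) = HasSize-element (edge-faces y ry) Fin.zero
    in (x , y , f) , ((rx , ry , rf , x≤y , y≤f) , refl) , refl
  ... | inj₂ (inj₁ (refl , refl)) =
    let e , re , x≤e , e≤y = VertexFigure.edge-between rx x≤y ry
    in (x , e , y) , ((rx , re , ry , x≤e , e≤y) , refl) , refl
  ... | inj₂ (inj₂ (refl , refl)) =
    let v , (rv , v≤x) = HasSize-element (edge-vertices x rx) Fin.zero
    in (v , x , y) , ((rv , rx , ry , v≤x , x≤y) , refl) , refl

  -- Without edges the chain {y} would be maximal, yet contain no element of rank 1.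
  edge-exists : Finite X → Elt → ∃ λ e → rank e ≡ 1
  edge-exists finite@(_ , enum , _ , _ , enum-onto) y with any? (λ i → rank (enum i) ℕ.≟ 1)
  ... | yes (i , ri) = enum i , ri
  ... | no no-edge = ⊥-elim (edgeless _ (proj₂ (proj₁ (proj₂ (proj₂ singleton-rank1)) Fin.zero)))
    where
    edgeless : ∀ e → rank e ≢ 1
    edgeless e re with enum-onto e tt
    ... | i , refl = no-edge (i , re)

    strict-edgeless : ∀ {a b} → a <ₚ b → ⊥
    strict-edgeless {a} {b} a<b@(a≤b , _) with <≤2-cases (rank-< a<b) (rank≤2 b)
    ... | inj₁ (_ , rb) = edgeless b rb
    ... | inj₂ (inj₁ (ra , rb)) = edgeless _ (proj₁ (proj₂ (VertexFigure.edge-between ra a≤b rb)))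
    ... | inj₂ (inj₂ (ra , _)) = edgeless a ra

    singleton : Elt → Set
    singleton x = x ≡ y

    maximal : ∀ z → (∀ x → singleton x → z ≤ₚ x ⊎ x ≤ₚ z) → singleton z
    maximal z comparable with HasSize-decEq (proj₂ finite) z y | comparable y refl
    ... | yes z≡y | _ = z≡y
    ... | no z≢y | inj₁ z≤y = ⊥-elim (strict-edgeless (z≤y , z≢y))
    ... | no z≢y | inj₂ y≤z = ⊥-elim (strict-edgeless (y≤z , z≢y ∘ sym))

    singleton-rank1 : HasSize (λ x → singleton x × rank x ≡ 1) 1
    singleton-rank1 = flags singleton ((λ { _ _ refl refl → inj₁ ≤-refl }) , maximal) 1 (s≤s z≤n)

  module Typed {p q : ℕ} (type : HasType X p q) where

    abstract
      flagsAt-size : ∀ {r x} → rank x ≡ r → HasSize (FlagAt r x) (flagCount p q r)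
      flagsAt-size {zero} {x} rx =
        HasSize-pairs (λ e f → x , e , f) (λ { _ _ _ _ refl → refl , refl })
          (proj₂ type x rx) (λ e (re , _) → edge-faces e re)
          (λ e f (re , x≤e) (rf , e≤f) → (rx , re , rf , x≤e , e≤f) , refl)
          λ { _ ((_ , re , rf , x≤e , e≤f) , refl) → _ , _ , (re , x≤e) , (rf , e≤f) , refl }
      flagsAt-size {suc zero} {x} rx =
        HasSize-pairs (λ v f → v , x , f) (λ { _ _ _ _ refl → refl , refl })
          (edge-vertices x rx) (λ _ _ → edge-faces x rx)
          (λ v f (rv , v≤x) (rf , x≤f) → (rv , rx , rf , v≤x , x≤f) , refl)
          λ { _ ((rv , _ , rf , v≤x , x≤f) , refl) → _ , _ , (rv , v≤x) , (rf , x≤f) , refl }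
      flagsAt-size {suc (suc zero)} {x} rx =
        HasSize-pairs (λ e v → v , e , x) (λ { _ _ _ _ refl → refl , refl })
          (proj₁ type x rx) (λ e (re , _) → edge-vertices e re)
          (λ e v (re , e≤x) (rv , v≤e) → (rv , re , rx , v≤e , e≤x) , refl)
          λ { _ ((rv , re , _ , v≤e , e≤x) , refl) → _ , _ , (re , e≤x) , (rv , v≤e) , refl }
      flagsAt-size {suc (suc (suc _))} {x} rx =
        contradiction (subst (_≤ 2) rx (rank≤2 x)) λ { (s≤s (s≤s ())) }

    flagAt : ∀ {r x} → Fin p → Fin q → rank x ≡ r → ∃ (FlagAt r x)
    flagAt {r} i j rx = HasSize-element (flagsAt-size rx) (flagCount-index i j r)

    vertexFlag : ∀ {v} → rank v ≡ 0 → Fin (q * 2) → Flag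
    vertexFlag rv = proj₁ (flagsAt-size rv)

    vertexFlag-at : ∀ {v} (rv : rank v ≡ 0) m → FlagAt 0 v (vertexFlag rv m)
    vertexFlag-at rv = proj₁ (proj₂ (proj₂ (flagsAt-size rv)))

    vertexFlag-injective : ∀ {v v′} (rv : rank v ≡ 0) (rv′ : rank v′ ≡ 0) m m′ →
      vertexFlag rv m ≡ vertexFlag rv′ m′ → v ≡ v′ × m ≡ m′
    vertexFlag-injective rv rv′ m m′ eq
      with trans (sym (proj₂ (vertexFlag-at rv m))) (trans (cong (component 0) eq) (proj₂ (vertexFlag-at rv′ m′)))
    ... | refl rewrite ≡-irrelevant rv rv′ = refl , proj₁ (proj₂ (flagsAt-size rv′)) m m′ eq

    -- The 2p flags of a face z come in 1-adjacent pairs sharing a vertex; the side of a flag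
    -- tells it apart from its partner.
    module FaceSides {z} (rz : rank z ≡ 2) where
      faceFlag : Fin (p * 2) → Flag
      faceFlag = proj₁ (flagsAt-size rz)

      faceFlag-injective : ∀ k k′ → faceFlag k ≡ faceFlag k′ → k ≡ k′
      faceFlag-injective = proj₁ (proj₂ (flagsAt-size rz))

      faceFlag-at : ∀ k → FlagAt 2 z (faceFlag k)
      faceFlag-at = proj₁ (proj₂ (proj₂ (flagsAt-size rz)))

      vertex : Fin (p * 2) → Elt
      vertex k = component 0 (faceFlag k)

      vertex-rank : ∀ k → rank (vertex k) ≡ 0
      vertex-rank k = proj₁ (proj₁ (faceFlag-at k))

      partner : Fin (p * 2) → Fin (p * 2)
      partner k = HasSize-index (flagsAt-size rz) (swap₁-flag (proj₁ (faceFlag-at k)) , proj₂ (faceFlag-at k))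

      partner-flag : ∀ k → faceFlag (partner k) ≡ swap₁ (proj₁ (faceFlag-at k))
      partner-flag k = proj₂ (proj₂ (proj₂ (proj₂ (flagsAt-size rz))) _
        (swap₁-flag (proj₁ (faceFlag-at k)) , proj₂ (faceFlag-at k)))

      partner-≢ : ∀ k → partner k ≢ k
      partner-≢ k pk≡k = swap₁-≢ (proj₁ (faceFlag-at k)) (trans (cong faceFlag (sym pk≡k)) (partner-flag k))

      same-vertex : ∀ k k′ → vertex k ≡ vertex k′ → k′ ≡ k ⊎ k′ ≡ partner k
      same-vertex k k′ same
        with swap₁-unique (proj₁ (faceFlag-at k)) (proj₁ (faceFlag-at k′)) (sym same)
               (trans (proj₂ (faceFlag-at k′)) (sym (proj₂ (faceFlag-at k))))
      ... | inj₁ eq = inj₁ (faceFlag-injective _ _ eq)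
      ... | inj₂ eq = inj₂ (faceFlag-injective _ _ (trans eq (sym (partner-flag k))))

      side : Fin (p * 2) → Fin 2
      side k = order k (partner k)

      side-injective : ∀ k k′ → vertex k ≡ vertex k′ → side k ≡ side k′ → k ≡ k′
      side-injective k k′ same sides with same-vertex k k′ same
      ... | inj₁ k′≡k = sym k′≡k
      ... | inj₂ refl with same-vertex (partner k) k (sym same)
      ... | inj₁ k≡pk = k≡pk
      ... | inj₂ k≡ppk = contradiction (trans sides (cong (order (partner k)) (sym k≡ppk)))
                                       (order-antisym (partner-≢ k ∘ sym))

    -- A flag k of the face and j ∈ Fin q give a flag at the vertex of k, indexed by j and the side of k.
    flags-lowerBound : ∀ {z} → rank z ≡ 2 → FlagsAtLeast (2 * p * q)
    flags-lowerBound rz = subst FlagsAtLeast (cong (_* q) (*-comm p 2)) (g , g-injective , g-flag)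
      where
      open FaceSides rz

      pairFlag : Fin (p * 2) × Fin q → Flag
      pairFlag (k , j) = vertexFlag (vertex-rank k) (combine j (side k))

      pairFlag-injective : ∀ kj kj′ → pairFlag kj ≡ pairFlag kj′ → kj ≡ kj′
      pairFlag-injective (k , j) (k′ , j′) eq with vertexFlag-injective _ _ _ _ eq
      ... | same , indices with combine-injective j (side k) j′ (side k′) indices
      ... | refl , sides with side-injective k k′ same sides
      ... | refl = refl

      g : Fin (p * 2 * q) → Flag
      g = pairFlag ∘ remQuot q

      g-injective : ∀ i i′ → g i ≡ g i′ → i ≡ i′
      g-injective i i′ eq = remQuot-injective q i i′ (pairFlag-injective _ _ eq)

      g-flag : ∀ i → IsFlag (g i)
      g-flag i = proj₁ (vertexFlag-at _ _)

module Covering (P Q : Polyhedron) {p q : ℕ} (typeP : HasType P p q) (typeQ : HasType Q p q)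
  (cov : Covers P Q) where
  module P = PolyhedronFacts P
  module Q = PolyhedronFacts Q
  open P using (OtherEdge)

  h : P.Elt → Q.Elt
  h = proj₁ cov

  h-onto : ∀ y → ∃ λ x → h x ≡ y
  h-onto = proj₁ (proj₂ cov)

  h-mono : ∀ x y → x P.≤ₚ y → h x Q.≤ₚ h y
  h-mono = proj₁ (proj₂ (proj₂ cov))

  h-rank : ∀ x → Q.rank (h x) ≡ P.rank x
  h-rank = proj₁ (proj₂ (proj₂ (proj₂ cov)))

  h-adjacent : ∀ i Φ Ψ → P.Adjacent i Φ Ψ → Q.Adjacent i (mapFlag h Φ) (mapFlag h Ψ)
  h-adjacent = proj₂ (proj₂ (proj₂ (proj₂ cov)))

  H : P.Flag → Q.Flag
  H = mapFlag h

  h-rank≡ : ∀ {x r} → P.rank x ≡ r → Q.rank (h x) ≡ r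
  h-rank≡ {x} = trans (h-rank x)

  H-flag : ∀ {Φ} → P.IsFlag Φ → Q.IsFlag (H Φ)
  H-flag (rv , re , rf , v≤e , e≤f) = h-rank≡ rv , h-rank≡ re , h-rank≡ rf , h-mono _ _ v≤e , h-mono _ _ e≤f

  H-flagAt : ∀ {r x Φ} → P.FlagAt r x Φ → Q.FlagAt r (h x) (H Φ)
  H-flagAt {r} {Φ = Φ} (fl , refl) = H-flag fl , component-mapFlag r h Φ

  h-separates-edges : ∀ {v e e′ f} → P.IsFlag (v , e , f) → P.IsFlag (v , e′ , f) → e ≢ e′ → h e ≢ h e′
  h-separates-edges fl fl′ e≢e′ =
    proj₁ (proj₂ (proj₂ (proj₂ (h-adjacent (Fin.suc Fin.zero) _ _ (fl , fl′ , refl , e≢e′ , refl)))))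

  h-separates-faces : ∀ {v e f f′} → P.IsFlag (v , e , f) → P.IsFlag (v , e , f′) → f ≢ f′ → h f ≢ h f′
  h-separates-faces fl fl′ f≢f′ =
    proj₂ (proj₂ (proj₂ (proj₂ (h-adjacent (Fin.suc (Fin.suc Fin.zero)) _ _ (fl , fl′ , refl , refl , f≢f′)))))

  -- The two faces at e have distinct images, so they are both faces at h e.
  face-lift : ∀ {x e f F} → P.IsFlag (x , e , f) → Q.rank F ≡ 2 → h e Q.≤ₚ F →
    ∃ λ f′ → P.IsFlag (x , e , f′) × h f′ ≡ F
  face-lift {x} {e} fl@(rx , re , rf , x≤e , e≤f) rF he≤F =
    let f′ , (rf′ , e≤f′) , f≢f′ = HasSize-other (P.edge-faces e re) (rf , e≤f)
        fl′ : P.IsFlag (x , e , f′)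
        fl′ = rx , re , rf′ , x≤e , e≤f′
    in Sum.[ (λ F≡hf → _ , fl , sym F≡hf) , (λ F≡hf′ → f′ , fl′ , sym F≡hf′) ]′
         (HasSize-two (Q.edge-faces (h e) (h-rank≡ re)) (h-rank≡ rf , h-mono _ _ e≤f)
           (h-rank≡ rf′ , h-mono _ _ e≤f′) (h-separates-faces fl fl′ f≢f′) (rF , he≤F))

  module VertexLift {x} (rx : P.rank x ≡ 0) where
    open Q.VertexFigure (h-rank≡ rx)

    Liftable : V → Set
    Liftable u = ∃₂ λ e f → P.IsFlag (x , e , f) × h e ≡ elt (inj₁ u)

    -- Crossing the figure edge g lifts the face elt g to a face f′ at e; the other edge of f′ at x
    -- covers an end of g, and not the end we came from, since h separates 1-adjacent flags.
    liftable-step : ∀ {u u′} → Adj u u′ → Liftable u → Liftable u′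
    liftable-step u~u′ (e , f , fl , he) with Adj⇒edge u~u′
    ... | g , u∈g , g-ends
      with face-lift fl (rank-elt-edge g) (subst (Q._≤ₚ elt (inj₂ g)) (sym he) (≤ᴵ-elt u∈g))
    ... | f′ , fl′ , hf′ with P.swap₁-flag fl′ | OtherEdge.distinct (P.other-edge fl′)
    ... | fl₁@(_ , re₁ , _ , x≤e₁ , e₁≤f′) | e≢e₁ with vertex-of (h-mono _ _ x≤e₁) (h-rank≡ re₁)
    ... | u″ , hu″ with g-ends u″ (elt-≤ᴵ (subst₂ Q._≤ₚ_ (sym hu″) hf′ (h-mono _ _ e₁≤f′)))
    ... | inj₁ refl = contradiction (trans he hu″) (h-separates-edges fl′ fl₁ e≢e₁)
    ... | inj₂ refl = _ , f′ , fl₁ , sym hu″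

    liftable-connected : ∀ {u u′} → Star Adj u u′ → Liftable u → Liftable u′
    liftable-connected = fold (λ u u′ → Liftable u → Liftable u′) (λ step rest → rest ∘ liftable-step step) id

    lift-through : ∀ {u e* F*} → Liftable u → elt (inj₁ u) ≡ e* → Q.rank F* ≡ 2 → e* Q.≤ₚ F* →
      ∃ λ Φ → P.IsFlag Φ × H Φ ≡ (h x , e* , F*)
    lift-through (e , f , fl , he) refl rF* e*≤F* with face-lift fl rF* (subst (Q._≤ₚ _) (sym he) e*≤F*)
    ... | f′ , fl′ , refl = (x , e , f′) , fl′ , cong (λ e′ → h x , e′ , h f′) he

    flag-lift : ∀ {e* F*} → Q.IsFlag (h x , e* , F*) → ∃ λ Φ → P.IsFlag Φ × H Φ ≡ (h x , e* , F*)
    flag-lift fl*@(_ , re* , rF* , hx≤e* , e*≤F*)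
      with HasSize-element (P.Typed.flagsAt-size typeP rx)
             (HasSize-index (Q.Typed.flagsAt-size typeQ (h-rank≡ rx)) (fl* , refl))
    ... | (_ , e₀ , f₀) , (fl₀@(_ , re₀ , _ , x≤e₀ , _) , refl)
      with vertex-of (h-mono _ _ x≤e₀) (h-rank≡ re₀) | vertex-of hx≤e* re*
    ... | u₀ , hu₀ | u* , hu* =
      lift-through (liftable-connected (Γ-connected u₀ u*) (e₀ , f₀ , fl₀ , sym hu₀)) hu* rF* e*≤F*

  H-onto : ∀ {Ψ} → Q.IsFlag Ψ → ∃ λ Φ → P.IsFlag Φ × H Φ ≡ Ψ
  H-onto {w , _ , _} fl@(rw , _) with h-onto w
  ... | x , refl = VertexLift.flag-lift (trans (sym (h-rank x)) rw) fl

module TightCover (P Q : Polyhedron) {p q : ℕ} (finP : Finite P) (finQ : Finite Q)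
  (typeP : HasType P p q) (typeQ : HasType Q p q) (cov : Covers P Q) (tight : Tight P p q) where
  open Covering P Q typeP typeQ cov public

  private
    enum : Fin (2 * p * q) → P.Flag
    enum = proj₁ tight

    enum-onto : ∀ Φ → P.IsFlag Φ → ∃ λ i → enum i ≡ Φ
    enum-onto = proj₂ (proj₂ (proj₂ tight))

  H∘enum-onto : ∀ Ψ → Q.IsFlag Ψ → ∃ λ i → H (enum i) ≡ Ψ
  H∘enum-onto Ψ fl with H-onto fl
  ... | Φ , flΦ , refl with enum-onto Φ flΦ
  ... | i , refl = i , refl

  H∘enum-injective : ∀ {z} → Q.rank z ≡ 2 → ∀ i j → H (enum i) ≡ H (enum j) → i ≡ j
  H∘enum-injective rz with Q.Typed.flags-lowerBound typeQ rz
  ... | g , g-injective , g-flag =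
    Pigeonhole.g-injective Q.IsFlag g (H ∘ enum) g-flag g-injective H∘enum-onto

  H-injective : ∀ {Φ Ψ} → P.IsFlag Φ → P.IsFlag Ψ → H Φ ≡ H Ψ → Φ ≡ Ψ
  H-injective flΦ@(_ , _ , rf , _) flΨ eq with enum-onto _ flΦ | enum-onto _ flΨ
  ... | i , refl | j , refl = cong enum (H∘enum-injective (h-rank≡ rf) i j eq)

  p,q-positive : P.Elt → Fin p × Fin q
  p,q-positive x =
    let e , re = P.edge-exists finP x
        Φ , flΦ , _ = HasSize-element (P.Typed.flagsAt-size typeP re) Fin.zero
        k , j = remQuot {2 * p} q (proj₁ (enum-onto Φ flΦ))
    in proj₂ (remQuot {2} p k) , j

  H-onto-at : ∀ {r x Ψ} → P.rank x ≡ r → Q.FlagAt r (h x) Ψ → ∃ λ Φ → P.FlagAt r x Φ × H Φ ≡ Ψ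
  H-onto-at {r} {x} rx Ψ-at = let i , HgΨ = f-onto _ Ψ-at in g i , g-at i , HgΨ
    where
    g : Fin (flagCount p q r) → P.Flag
    g = proj₁ (P.Typed.flagsAt-size typeP rx)

    g-at : ∀ i → P.FlagAt r x (g i)
    g-at = proj₁ (proj₂ (proj₂ (P.Typed.flagsAt-size typeP rx)))

    H∘g-injective : ∀ i j → H (g i) ≡ H (g j) → i ≡ j
    H∘g-injective i j = proj₁ (proj₂ (P.Typed.flagsAt-size typeP rx)) i j
                      ∘ H-injective (proj₁ (g-at i)) (proj₁ (g-at j))

    open Pigeonhole (Q.FlagAt r (h x)) (H ∘ g) (proj₁ (Q.Typed.flagsAt-size typeQ (h-rank≡ rx)))
      (λ i → H-flagAt {r} (g-at i)) H∘g-injective (proj₂ (proj₂ (proj₂ (Q.Typed.flagsAt-size typeQ (h-rank≡ rx)))))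

  h-injective : ∀ x y → h x ≡ h y → x ≡ y
  h-injective x y hx≡hy with p,q-positive x
  ... | i , j with P.Typed.flagAt typeP i j (trans (sym (h-rank y)) (trans (cong Q.rank (sym hx≡hy)) (h-rank x)))
  ... | Ψ , flΨ , refl with H-onto-at refl (H-flag flΨ , trans (component-mapFlag (P.rank x) h Ψ) (sym hx≡hy))
  ... | Φ , (flΦ , Φ∋x) , HΦ≡HΨ = trans (sym Φ∋x) (cong (component (P.rank x)) (H-injective flΦ flΨ HΦ≡HΨ))

  h-reflects-≤ : ∀ x y → h x Q.≤ₚ h y → x P.≤ₚ y
  h-reflects-≤ x y hx≤hy with HasSize-decEq (proj₂ finQ) (h x) (h y)
  ... | yes hx≡hy = P.≤-reflexive (h-injective x y hx≡hy)
  ... | no hx≢hy with Q.common-flag (h-rank x) (h-rank y) (hx≤hy , hx≢hy)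
  ... | Ψ , (flΨ , Ψ∋hx) , Ψ∋hy with H-onto flΨ
  ... | Φ , flΦ , refl =
    subst₂ P._≤ₚ_ (h-injective _ x (trans (sym (component-mapFlag (P.rank x) h Φ)) Ψ∋hx))
                  (h-injective _ y (trans (sym (component-mapFlag (P.rank y) h Φ)) Ψ∋hy))
                  (P.component-≤ flΦ (ℕ.<⇒≤ (subst₂ _<_ (h-rank x) (h-rank y) (Q.rank-< (hx≤hy , hx≢hy)))))

proposition2p7 : (P Q : Polyhedron) (p q : ℕ) →
    Finite P → Finite Q → HasType P p q → HasType Q p q →
    Covers P Q → Tight P p q → Isomorphic P Q
proposition2p7 P Q p q finP finQ typeP typeQ cov tight =
  h , h-injective , h-onto , (λ x y → h-mono x y , h-reflects-≤ x y) , h-rank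
  where open TightCover P Q finP finQ typeP typeQ cov tight
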